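{- Let $G=(V,E)$ be an $n$-vertex unweighted undirected graph with source $s$, let $T_0$ be a BFS tree of $G$ rooted at $s$, and let $H=T_0\cup E^*_{new}$ be the subgraph produced by the construction described in the context. Then for every vertex $v$ and every edge $e\in E$, $\mathrm{dist}(s,v,H\setminus\{e\})\le 3\cdot\mathrm{dist}(s,v,G\setminus\{e\})$.
   Context: Notation: $\pi(x,y)$ is the unique $x$–$y$ path in $T_0$; $\mathrm{dist}(u,v,G')$ is the number of edges on a shortest $u$–$v$ path in $G'$. Fix an ordering $e_1,\dots,e_m$ of $E$ and $u_1,\dots,u_n$ of $V$. For each $i$, define edge weights $W_i$ by $W_i(e_\ell)=w_\ell$ if $e_\ell\in E(T_0)\setminus E(\pi(s,u_i))$, $W_i(e_\ell)=w_\ell+\epsilon_2$ if $e_\ell\in\pi(s,u_i)$, and $W_i(e_\ell)=w_\ell+\epsilon_1$ otherwise, where $w_\ell=n^6 2^{m+1}+2^\ell$, $\epsilon_1=n^3 2^{m+1}$, $\epsilon_2=2^{m+1}$. For each $i$ and each edge $e_j\in\pi(s,u_i)$, let $P^*_{i,j}$ be the (unique) minimum $W_i$-weight $s$–$u_i$ path in $G\setminus\{e_j\}$. An edge is new if it is not in $T_0$; $P^*_{i,j}$ is new-ending if its last edge is new, and $\mathrm{FirstNew}(P^*_{i,j})$ denotes the new edge of $P^*_{i,j}$ closest to $s$. Let $E^*_i=\{\mathrm{FirstNew}(P^*_{i,j}) : e_j\in\pi(s,u_i),\ P^*_{i,j}\text{ new-ending}\}$ and $E^*_{new}=\bigcup_i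 E^*_i$. -}

module Defs where

open import Data.Nat using (ℕ; zero; suc; _+_; _*_; _^_; _≤_)
open import Data.Fin using (Fin; toℕ)
open import Data.Bool using (Bool; true; false)
open import Data.List using (List; []; _∷_; _++_; length)
open import Data.List.Relation.Unary.All using (All)
open import Data.List.Relation.Unary.Unique.Propositional using (Unique)
open import Data.List.Membership.Propositional using (_∈_)
open import Data.Product using (Σ; _×_; _,_; proj₁; proj₂)
open import Data.Sum using (_⊎_)
open import Data.Unit using (⊤)
open import Relation.Nullary using (¬_)
open import Relation.Binary.PropositionalEquality using (_≡_; _≢_)

-- Graphs: n vertices (Fin n), m edges e_0 … e_{m-1} (the paper's
-- e_1 … e_m; index ℓ here corresponds to e_{ℓ+1}).  Each edge is an
-- unordered pair, stored as an ordered pair of endpoints.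

Step : {n m : ℕ} → (Fin m → Fin n × Fin n) → Fin m → Fin n → Fin n → Set
Step E k x y = (E k ≡ (x , y)) ⊎ (E k ≡ (y , x))

record Graph (n m : ℕ) : Set where
  field
    edge     : Fin m → Fin n × Fin n
    loopless : ∀ k → proj₁ (edge k) ≢ proj₂ (edge k)
    simple   : ∀ k k' → Step edge k' (proj₁ (edge k)) (proj₂ (edge k)) → k ≡ k'
open Graph public

EdgeSet : ℕ → Set₁
EdgeSet m = Fin m → Set

data Walk {n m : ℕ} (G : Graph n m) (A : EdgeSet m) :
          Fin n → Fin n → List (Fin n) → List (Fin m) → Set where
  nil  : ∀ x → Walk G A x x (x ∷ []) []
  cons : ∀ {k x y z vs ks} → A k → Step (edge G) k x y →
         Walk G A y z vs ks → Walk G A x z (x ∷ vs) (k ∷ ks)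

Path : {n m : ℕ} → Graph n m → EdgeSet m →
       Fin n → Fin n → List (Fin n) → List (Fin m) → Set
Path G A x z vs ks = Walk G A x z vs ks × Unique vs

-- dist(x, y, (V, A)) = d   (number of edges of a shortest walk;
-- no such d exists when y is unreachable, i.e. the distance is ∞)
IsDist : {n m : ℕ} → Graph n m → EdgeSet m → Fin n → Fin n → ℕ → Set
IsDist {n} {m} G A x y d =
  Σ (List (Fin n)) (λ vs → Σ (List (Fin m)) (λ ks → Walk G A x y vs ks × length ks ≡ d))
  × (∀ vs ks → Walk G A x y vs ks → d ≤ length ks)

AllEdges : {m : ℕ} → EdgeSet m
AllEdges _ = ⊤

InT : {m : ℕ} → (Fin m → Bool) → EdgeSet m
InT T0 k = T0 k ≡ true

Without : {m : ℕ} → EdgeSet m → Fin m → EdgeSet m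
Without A e k = A k × k ≢ e

-- BFS tree of G rooted at s: a tree (acyclic, connected, containing s)
-- spanning exactly the vertices reachable from s, in which every vertex
-- has the same distance from s as in G.
record IsBFSTree {n m : ℕ} (G : Graph n m) (s : Fin n) (T0 : Fin m → Bool) : Set where
  field
    shortest  : ∀ v d → IsDist G AllEdges s v d → IsDist G (InT T0) s v d
    connected : ∀ k → T0 k ≡ true →
                Σ (List (Fin n)) λ vs → Σ (List (Fin m)) λ ks →
                  Walk G (InT T0) s (proj₁ (edge G k)) vs ks
    acyclic   : ∀ x y vs ks vs' ks' → Path G (InT T0) x y vs ks →
                Path G (InT T0) x y vs' ks' → ks ≡ ks'

OnPi : {n m : ℕ} → Graph n m → (Fin m → Bool) → Fin n → Fin n → Fin m → Set
OnPi {n} {m} G T0 s u j =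
  Σ (List (Fin n)) λ vs → Σ (List (Fin m)) λ ks → Path G (InT T0) s u vs ks × j ∈ ks

w : (n m : ℕ) → Fin m → ℕ
w n m ℓ = n ^ 6 * 2 ^ (m + 1) + 2 ^ (toℕ ℓ + 1)

ε₁ : (n m : ℕ) → ℕ
ε₁ n m = n ^ 3 * 2 ^ (m + 1)

ε₂ : (n m : ℕ) → ℕ
ε₂ n m = 2 ^ (m + 1)

data EdgeW {n m : ℕ} (G : Graph n m) (T0 : Fin m → Bool) (s u : Fin n) :
           Fin m → ℕ → Set where
  tree : ∀ {ℓ} → T0 ℓ ≡ true → ¬ OnPi G T0 s u ℓ → EdgeW G T0 s u ℓ (w n m ℓ)
  onpi : ∀ {ℓ} → OnPi G T0 s u ℓ → EdgeW G T0 s u ℓ (w n m ℓ + ε₂ n m)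
  other : ∀ {ℓ} → T0 ℓ ≡ false → EdgeW G T0 s u ℓ (w n m ℓ + ε₁ n m)

data PathW {n m : ℕ} (G : Graph n m) (T0 : Fin m → Bool) (s u : Fin n) :
           List (Fin m) → ℕ → Set where
  []  : PathW G T0 s u [] 0
  _∷_ : ∀ {k ks c d} → EdgeW G T0 s u k c → PathW G T0 s u ks d →
        PathW G T0 s u (k ∷ ks) (c + d)

IsPStar : {n m : ℕ} → Graph n m → (Fin m → Bool) → Fin n → Fin n → Fin m →
          List (Fin n) → List (Fin m) → Set
IsPStar {n} {m} G T0 s u j vs ks =
  Path G (Without AllEdges j) s u vs ks ×
  Σ ℕ λ c → PathW G T0 s u ks c ×
    (∀ vs' ks' c' → Path G (Without AllEdges j) s u vs' ks' →
       PathW G T0 s u ks' c' → c ≤ c')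

NewEnding : {m : ℕ} → (Fin m → Bool) → List (Fin m) → Set
NewEnding {m} T0 ks = Σ (List (Fin m)) λ pre → Σ (Fin m) λ k →
  ks ≡ pre ++ k ∷ [] × T0 k ≡ false

IsFirstNew : {m : ℕ} → (Fin m → Bool) → List (Fin m) → Fin m → Set
IsFirstNew {m} T0 ks f = Σ (List (Fin m)) λ pre → Σ (List (Fin m)) λ post →
  ks ≡ pre ++ f ∷ post × All (InT T0) pre × T0 f ≡ false

EStarNew : {n m : ℕ} → Graph n m → Fin n → (Fin m → Bool) → EdgeSet m
EStarNew {n} {m} G s T0 f =
  Σ (Fin n) λ u → Σ (Fin m) λ j → OnPi G T0 s u j ×
  Σ (List (Fin n)) λ vs → Σ (List (Fin m)) λ ks →
    IsPStar G T0 s u j vs ks × NewEnding T0 ks × IsFirstNew T0 ks f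

H : {n m : ℕ} → Graph n m → Fin n → (Fin m → Bool) → EdgeSet m
H G s T0 k = InT T0 k ⊎ EStarNew G s T0 k

-- Induction on L, the length of an s–v walk avoiding e. If the tree path π(s,v) avoids e,
-- it lies in H. Otherwise let P* be the replacement path to v; the term n⁶2^{m+1} in every
-- weight makes W-weight compare edge counts first, so |P*| ≤ L. If the last edge of P* is a
-- tree edge, the induction hypothesis applies to the rest of P*. Otherwise let f, ending at y,
-- be the first new edge of P*: the prefix of P* up to f lies in H (f ∈ E*new) and has length
-- ≤ L. The tree path π(s,y), also of length ≤ L, must contain e, since otherwise π(s,y)
-- followed by the remainder of P* would be lighter than P* (the ε₁ of f outweighs the ε₂
-- surplus of the tree edges). Both π(s,y) and π(s,v) traverse e towards the same endpoint q,
-- so going s ⇝ y along P*, back y ⇝ q along π(s,y) and on q ⇝ v along π(s,v) avoids e and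
-- takes at most 3L steps.

module Submission where

open import Defs
open import Data.Bool using (Bool; true; false)
import Data.Bool.Properties as Bool
open import Data.Empty using (⊥; ⊥-elim)
open import Data.Fin using (Fin; toℕ)
import Data.Fin.Properties as Fin
open import Data.List using (List; []; _∷_; _++_; length; lookup; map; reverse; initLast; _∷ʳ′_)
open import Data.List.Properties
  using (++-conicalʳ; length-++; length-++-≤ˡ; length-++-sucʳ; length-reverse; map-++; unfold-reverse; ∷ʳ-injective)
open import Data.List.Membership.Propositional using (_∈_; _∉_)
open import Data.List.Membership.Propositional.Properties using (∈-lookup)
open import Data.List.Relation.Binary.Sublist.Propositional using (_⊆_; []; _∷_; _∷ʳ_; ⊆-refl; ⊆-trans)
open import Data.List.Relation.Binary.Sublist.Propositional.Properties using (length-mono-≤)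
open import Data.List.Relation.Unary.All as All using (All; []; _∷_)
open import Data.List.Relation.Unary.All.Properties using (¬Any⇒All¬)
open import Data.List.Relation.Unary.Any as Any using (Any; here; there)
import Data.List.Relation.Unary.Any.Properties as Any
open import Data.List.Relation.Unary.AllPairs using ([]; _∷_)
open import Data.List.Relation.Unary.Unique.Propositional using (Unique)
import Data.List.Relation.Unary.Unique.DecPropositional as UniqueDec
open import Data.Nat using (ℕ; zero; suc; _+_; _*_; _^_; _≤_; _<_; z≤n; s≤s; NonZero)
open import Data.Nat.Properties
open import Data.Nat.Induction using (<-rec)
open import Data.Nat.ListAction using (sum)
open import Data.Nat.ListAction.Properties using (sum-++)
open import Data.Nat.Tactic.RingSolver using (solve-∀)
open import Data.Product using (Σ; ∃; ∃₂; _×_; _,_; proj₁; proj₂)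
import Data.Product.Properties as Product
open import Data.Sum using (_⊎_; inj₁; inj₂)
open import Data.Unit using (tt)
open import Function using (_∘_)
open import Relation.Nullary using (Dec; yes; no; ¬?; contradiction)
open import Relation.Nullary.Decidable using (map′; _×-dec_; _⊎-dec_; _→-dec_; decidable-stable)
open import Relation.Unary using (Decidable)
open import Relation.Binary.Definitions using (DecidableEquality)
open import Relation.Binary.PropositionalEquality

module BoundedSearch {k : ℕ} where

  ∃-length≤? : ∀ N (P : List (Fin k) → Set) → Decidable P →
               Dec (∃ λ xs → length xs ≤ N × P xs)
  ∃-length≤? zero P P? =
    map′ (λ p → [] , z≤n , p) (λ { ([] , _ , p) → p ; (_ ∷ _ , () , _) }) (P? [])
  ∃-length≤? (suc N) P P? =
    map′ (λ { (inj₁ p) → [] , z≤n , p ; (inj₂ (x , xs , l , p)) → x ∷ xs , s≤s l , p })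
         (λ { ([] , _ , p) → inj₁ p ; (x ∷ xs , s≤s l , p) → inj₂ (x , xs , l , p) })
         (P? [] ⊎-dec Fin.any? λ x → ∃-length≤? N (P ∘ (x ∷_)) (P? ∘ (x ∷_)))

  ∀-length≤? : ∀ N (P : List (Fin k) → Set) → Decidable P →
               Dec (∀ xs → length xs ≤ N → P xs)
  ∀-length≤? zero P P? =
    map′ (λ p → λ { [] _ → p ; (_ ∷ _) () }) (λ f → f [] z≤n) (P? [])
  ∀-length≤? (suc N) P P? =
    map′ (λ { (p , f) → λ { [] _ → p ; (x ∷ xs) (s≤s l) → f x xs l } })
         (λ g → g [] z≤n , λ x xs l → g (x ∷ xs) (s≤s l))
         (P? [] ×-dec Fin.all? λ x → ∀-length≤? N (P ∘ (x ∷_)) (P? ∘ (x ∷_)))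

  ∃?-bounded : ∀ N (P : List (Fin k) → Set) → Decidable P →
               (∀ {xs} → P xs → length xs ≤ N) → Dec (∃ P)
  ∃?-bounded N P P? bounded =
    map′ (λ (xs , _ , p) → xs , p) (λ (xs , p) → xs , bounded p , p) (∃-length≤? N P P?)

  ∀?-bounded : ∀ N (P : List (Fin k) → Set) → Decidable P →
               (∀ {xs} → N < length xs → P xs) → Dec (∀ xs → P xs)
  ∀?-bounded N P P? beyond = map′ extend (λ f xs _ → f xs) (∀-length≤? N P P?)
    where
    extend : (∀ xs → length xs ≤ N → P xs) → ∀ xs → P xs
    extend f xs with length xs ≤? N
    ... | yes l = f xs l
    ... | no l = beyond (≰⇒> l)

open BoundedSearch

least : {Q : ℕ → Set} → Decidable Q → ∀ {L} → Q L → ∃ λ d → Q d × (∀ {k} → Q k → d ≤ k)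
least Q? {zero} q = 0 , q , λ _ → z≤n
least Q? {suc L} q with Q? 0
... | yes q₀ = 0 , q₀ , λ _ → z≤n
... | no ¬q₀ with least (Q? ∘ suc) q
...   | d , q_d , minimal =
  suc d , q_d , λ { {zero} q₀ → contradiction q₀ ¬q₀ ; {suc k} q_k → s≤s (minimal q_k) }

unique⇒length≤ : ∀ {k} {xs : List (Fin k)} → Unique xs → length xs ≤ k
unique⇒length≤ {k} {xs} u with length xs ≤? k
... | yes l = l
... | no l with Fin.pigeonhole (≰⇒> l) (lookup xs)
...   | i , j , i<j , same = contradiction same (distinct u i j i<j)
  where
  distinct : ∀ {xs : List (Fin k)} → Unique xs → ∀ i j → i Data.Fin.< j → lookup xs i ≢ lookup xs j
  distinct (x∉xs ∷ _) Fin.zero (Fin.suc j) _ = All.lookup x∉xs (∈-lookup j)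
  distinct (_ ∷ u) (Fin.suc i) (Fin.suc j) (s≤s i<j) = distinct u i j i<j

split-last : ∀ {A : Set} → DecidableEquality A → ∀ {x : A} {xs} → x ∈ xs →
             ∃₂ λ as bs → xs ≡ as ++ x ∷ bs × x ∉ bs
split-last _≟_ {x} {y ∷ xs} x∈ with Any.any? (x ≟_) xs
... | yes x∈xs = let as , bs , eq , x∉bs = split-last _≟_ x∈xs in y ∷ as , bs , cong (y ∷_) eq , x∉bs
... | no x∉xs with x∈
...   | here refl = [] , xs , refl , x∉xs
...   | there x∈xs = contradiction x∈xs x∉xs

length-snoc : ∀ {A : Set} (xs : List A) x → length (xs ++ x ∷ []) ≡ suc (length xs)
length-snoc xs x = trans (length-++ xs) (+-comm (length xs) 1)

∈⇒length>0 : ∀ {A : Set} {x : A} {xs} → x ∈ xs → 0 < length xs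
∈⇒length>0 (here _) = s≤s z≤n
∈⇒length>0 (there _) = s≤s z≤n

first-new : ∀ {m} (T0 : Fin m → Bool) {ks} → Any (λ k → T0 k ≡ false) ks → ∃ (IsFirstNew T0 ks)
first-new T0 {k ∷ ks} new with T0 k in tk
... | false = k , [] , ks , refl , [] , tk
... | true with new
...   | here fk = contradiction (trans (sym tk) fk) λ ()
...   | there new' = let f , pre , post , eq , tree-pre , nf = first-new T0 new' in
                     f , k ∷ pre , post , cong (k ∷_) eq , tk ∷ tree-pre , nf

new-ending⇒new : ∀ {m} {T0 : Fin m → Bool} {ks} → NewEnding T0 ks → Any (λ k → T0 k ≡ false) ks
new-ending⇒new (pre , _ , refl , nk) = Any.++⁺ʳ pre (here nk)

module _ {A : Set} (f : A → ℕ) where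

  sum-map-++ : ∀ xs ys → sum (map f (xs ++ ys)) ≡ sum (map f xs) + sum (map f ys)
  sum-map-++ xs ys = trans (cong sum (map-++ f xs ys)) (sum-++ (map f xs) (map f ys))

  sum-map-mono-⊆ : ∀ {xs ys} → xs ⊆ ys → sum (map f xs) ≤ sum (map f ys)
  sum-map-mono-⊆ [] = z≤n
  sum-map-mono-⊆ (y ∷ʳ p) = ≤-trans (sum-map-mono-⊆ p) (m≤n+m _ (f y))
  sum-map-mono-⊆ (refl ∷ p) = +-monoʳ-≤ _ (sum-map-mono-⊆ p)

  sum-map-≥ : ∀ {c} → (∀ x → c ≤ f x) → ∀ xs → length xs * c ≤ sum (map f xs)
  sum-map-≥ c≤f [] = z≤n
  sum-map-≥ c≤f (x ∷ xs) = +-mono-≤ (c≤f x) (sum-map-≥ c≤f xs)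

  sum-map-≤ : ∀ {c} {P : A → Set} → (∀ {x} → P x → f x ≤ c) → ∀ {xs} → All P xs →
              sum (map f xs) ≤ length xs * c
  sum-map-≤ f≤c [] = z≤n
  sum-map-≤ f≤c (p ∷ ps) = +-mono-≤ (f≤c p) (sum-map-≤ f≤c ps)

n≤n^3 : ∀ k → k ≤ k ^ 3
n≤n^3 zero = z≤n
n≤n^3 (suc k) = subst (_≤ suc k * suc k ^ 2) (*-identityʳ (suc k)) (*-monoʳ-≤ (suc k) (m^n>0 (suc k) 2))

q+q*n^3<n^6 : ∀ {q n} → q < n → q + q * n ^ 3 < n ^ 6
q+q*n^3<n^6 {q} {n} q<n = begin-strict
  q + q * n ^ 3      <⟨ +-monoˡ-< (q * n ^ 3) (<-≤-trans q<n (n≤n^3 n)) ⟩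
  suc q * n ^ 3      ≤⟨ *-monoˡ-≤ (n ^ 3) (≤-trans q<n (n≤n^3 n)) ⟩
  n ^ 3 * n ^ 3      ≡⟨ ^-distribˡ-+-* n 3 3 ⟨
  n ^ 6              ∎
  where open ≤-Reasoning

t+t<n^3 : ∀ {t n} → t < n → t + t < n ^ 3
t+t<n^3 {t} {suc k} (s≤s t≤k) = begin-strict
  t + t              ≤⟨ +-mono-≤ t≤k t≤k ⟩
  k + k              ≤⟨ +-monoʳ-≤ k (m≤m*n k (suc k)) ⟩
  k + k * suc k      <⟨ n<1+n _ ⟩
  suc k * suc k      ≤⟨ *-monoʳ-≤ (suc k) (m≤m*n (suc k) (suc k ^ 1)) ⟩
  suc k ^ 3          ∎
  where open ≤-Reasoning

allEdges? : ∀ {m} → Decidable (AllEdges {m})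
allEdges? _ = yes tt

without? : ∀ {m} {A : EdgeSet m} → Decidable A → ∀ e → Decidable (Without A e)
without? A? e k = A? k ×-dec ¬? (k Fin.≟ e)

module Walks {n m : ℕ} (G : Graph n m) where

  step-sym : ∀ {k x y} → Step (edge G) k x y → Step (edge G) k y x
  step-sym (inj₁ p) = inj₂ p
  step-sym (inj₂ p) = inj₁ p

  step? : ∀ k x y → Dec (Step (edge G) k x y)
  step? k x y = edge G k ≟ₑ (x , y) ⊎-dec edge G k ≟ₑ (y , x)
    where _≟ₑ_ = Product.≡-dec Fin._≟_ Fin._≟_

  step-endpoints : ∀ {k x y x' y'} → Step (edge G) k x y → Step (edge G) k x' y' →
                   y ≡ y' ⊎ (y ≡ x' × x ≡ y')
  step-endpoints (inj₁ p) (inj₁ q) with trans (sym p) q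
  ... | refl = inj₁ refl
  step-endpoints (inj₁ p) (inj₂ q) with trans (sym p) q
  ... | refl = inj₂ (refl , refl)
  step-endpoints (inj₂ p) (inj₁ q) with trans (sym p) q
  ... | refl = inj₂ (refl , refl)
  step-endpoints (inj₂ p) (inj₂ q) with trans (sym p) q
  ... | refl = inj₁ refl

  EdgeWalk : EdgeSet m → Fin n → Fin n → List (Fin m) → Set
  EdgeWalk A x y ks = ∃ λ vs → Walk G A x y vs ks

  WalkWithin : EdgeSet m → Fin n → Fin n → ℕ → Set
  WalkWithin A x y L = ∃ λ ks → EdgeWalk A x y ks × length ks ≤ L

  walk-starts : ∀ {A x y v vs ks} → Walk G A x y (v ∷ vs) ks → x ≡ v
  walk-starts (nil _) = refl
  walk-starts (cons _ _ _) = refl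

  walk-vertices : ∀ {A x y vs ks} → Walk G A x y vs ks → length vs ≡ suc (length ks)
  walk-vertices (nil _) = refl
  walk-vertices (cons _ _ w) = cong suc (walk-vertices w)

  walk-edges : ∀ {A x y vs ks} → Walk G A x y vs ks → All A ks
  walk-edges (nil _) = []
  walk-edges (cons a _ w) = a ∷ walk-edges w

  walk-restrict : ∀ {A B x y vs ks} → All B ks → Walk G A x y vs ks → Walk G B x y vs ks
  walk-restrict [] (nil x) = nil x
  walk-restrict (b ∷ bs) (cons _ st w) = cons b st (walk-restrict bs w)

  walk-mono : ∀ {A B : EdgeSet m} {x y ks} → (∀ {k} → A k → B k) →
              EdgeWalk A x y ks → EdgeWalk B x y ks
  walk-mono A⊆B (vs , w) = vs , walk-restrict (All.map A⊆B (walk-edges w)) w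

  inG : ∀ {A x y ks} → EdgeWalk A x y ks → EdgeWalk AllEdges x y ks
  inG = walk-mono λ _ → tt

  edgeʷ : ∀ {A k x y} → A k → Step (edge G) k x y → EdgeWalk A x y (k ∷ [])
  edgeʷ a st = _ , cons a st (nil _)

  _++ʷ_ : ∀ {A x y z ks ks'} → EdgeWalk A x y ks → EdgeWalk A y z ks' → EdgeWalk A x z (ks ++ ks')
  (_ , nil _) ++ʷ w' = w'
  (_ , cons a st w) ++ʷ w' = let vs , w'' = (_ , w) ++ʷ w' in _ , cons a st w''

  splitʷ : ∀ {A x z} ks {ks'} → EdgeWalk A x z (ks ++ ks') →
           ∃ λ y → EdgeWalk A x y ks × EdgeWalk A y z ks'
  splitʷ [] w = _ , (_ , nil _) , w
  splitʷ (k ∷ ks) (_ , cons a st w) =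
    let y , w₁ , w₂ = splitʷ ks (_ , w) in y , (_ , cons a st (proj₂ w₁)) , w₂

  reverseʷ : ∀ {A x y ks} → EdgeWalk A x y ks → EdgeWalk A y x (reverse ks)
  reverseʷ (_ , nil x) = _ , nil x
  reverseʷ {ks = k ∷ ks} (_ , cons a st w) =
    subst (EdgeWalk _ _ _) (sym (unfold-reverse k ks)) (reverseʷ (_ , w) ++ʷ edgeʷ a (step-sym st))

  WalkOfLength : EdgeSet m → Fin n → Fin n → ℕ → Set
  WalkOfLength A x y L = ∃ λ ks → EdgeWalk A x y ks × length ks ≡ L

  walkOfLength? : ∀ {A} → Decidable A → ∀ x y L → Dec (WalkOfLength A x y L)
  walkOfLength? A? x y zero =
    map′ (λ { refl → [] , (_ , nil x) , refl }) (λ { ([] , (_ , nil _) , _) → refl }) (x Fin.≟ y)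
  walkOfLength? A? x y (suc L) =
    map′ (λ (k , z , a , st , ks , w , l) → k ∷ ks , edgeʷ a st ++ʷ w , cong suc l)
         (λ { (k ∷ ks , (_ , cons {y = z} a st w) , l) → k , z , a , st , ks , (_ , w) , suc-injective l })
         (Fin.any? λ k → Fin.any? λ z → A? k ×-dec step? k x z ×-dec walkOfLength? A? z y L)

  dist-of-walk : ∀ {A x y ks} → Decidable A → EdgeWalk A x y ks →
                 ∃ λ d → IsDist G A x y d × d ≤ length ks
  dist-of-walk A? w with least (walkOfLength? A? _ _) (_ , w , refl)
  ... | _ , (ks , (vs , w') , refl) , minimal =
    length ks , ((vs , ks , w' , refl) , λ vs ks w → minimal (ks , (vs , w) , refl)) , minimal (_ , w , refl)

  PathAlong : EdgeSet m → Fin n → Fin n → List (Fin m) → Set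
  PathAlong A x y ks = ∃₂ λ vs' ks' → Path G A x y vs' ks' × ks' ⊆ ks

  path-from : ∀ {A x y z vs ks} → Walk G A y z vs ks → Unique vs → x ∈ vs → PathAlong A x z ks
  path-from (nil y) u (here refl) = _ , _ , (nil y , u) , []
  path-from (cons a st w) u (here refl) = _ , _ , (cons a st w , u) , ⊆-refl
  path-from (cons {k = k} a st w) (_ ∷ u) (there x∈vs) =
    let vs' , ks' , p , sub = path-from w u x∈vs in vs' , ks' , p , k ∷ʳ sub

  walk⇒path : ∀ {A x z vs ks} → Walk G A x z vs ks → PathAlong A x z ks
  walk⇒path (nil x) = _ , _ , (nil x , [] ∷ []) , []
  walk⇒path (cons {x = x} a st w) with walk⇒path w
  ... | vs' , ks' , (w' , u') , sub with Any.any? (x Fin.≟_) vs'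
  ...   | yes x∈vs' = let vs'' , ks'' , p , sub' = path-from w' u' x∈vs' in
                      vs'' , ks'' , p , _ ∷ʳ ⊆-trans sub' sub
  ...   | no x∉vs' = _ , _ , (cons a st w' , ¬Any⇒All¬ vs' x∉vs' ∷ u') , refl ∷ sub

  path-length< : ∀ {A x z vs ks} → Path G A x z vs ks → length ks < n
  path-length< (w , u) = subst (_≤ n) (walk-vertices w) (unique⇒length≤ u)

  walk? : ∀ {A} → Decidable A → ∀ x z vs ks → Dec (Walk G A x z vs ks)
  walk? A? x z [] ks = no λ ()
  walk? A? x z (v ∷ []) [] =
    map′ (λ { (refl , refl) → nil x }) (λ { (nil _) → refl , refl }) (x Fin.≟ v ×-dec v Fin.≟ z)
  walk? A? x z (v ∷ []) (k ∷ ks) = no λ { (cons _ _ ()) }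
  walk? A? x z (v ∷ v' ∷ vs) [] = no λ ()
  walk? {A} A? x z (v ∷ v' ∷ vs) (k ∷ ks) =
    map′ (λ { (refl , a , st , w) → cons a st w }) uncons
         (x Fin.≟ v ×-dec A? k ×-dec step? k v v' ×-dec walk? A? v' z (v' ∷ vs) ks)
    where
    uncons : Walk G A x z (v ∷ v' ∷ vs) (k ∷ ks) →
             x ≡ v × A k × Step (edge G) k v v' × Walk G A v' z (v' ∷ vs) ks
    uncons (cons a st w) with walk-starts w
    ... | refl = refl , a , st , w

  path? : ∀ {A} → Decidable A → ∀ x z vs ks → Dec (Path G A x z vs ks)
  path? A? x z vs ks = walk? A? x z vs ks ×-dec UniqueDec.unique? Fin._≟_ vs

  ∃-path? : ∀ {A x z} (Q : List (Fin n) → List (Fin m) → Set) → (∀ vs ks → Dec (Q vs ks)) →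
            (∀ {vs ks} → Q vs ks → Path G A x z vs ks) → Dec (∃₂ Q)
  ∃-path? Q Q? path =
    ∃?-bounded n _ (λ vs → ∃?-bounded n _ (Q? vs) (<⇒≤ ∘ path-length< ∘ path))
                   (λ (_ , q) → unique⇒length≤ (proj₂ (path q)))

  ∀-path? : ∀ {A} → Decidable A → ∀ x z (P : List (Fin n) → List (Fin m) → Set) →
            (∀ vs ks → Dec (P vs ks)) → Dec (∀ vs ks → Path G A x z vs ks → P vs ks)
  ∀-path? A? x z P P? =
    ∀?-bounded n _ (λ vs → ∀?-bounded n _ (λ ks → path? A? x z vs ks →-dec P? vs ks)
                                         (λ long p → contradiction (path-length< p) (<-asym long)))
                   (λ long ks p → contradiction (unique⇒length≤ (proj₂ p)) (<⇒≱ long))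

module BFSTree {n m : ℕ} (G : Graph n m) (s : Fin n) (T0 : Fin m → Bool) where
  open Walks G

  Tree : EdgeSet m
  Tree = InT T0

  tree? : Decidable Tree
  tree? k = T0 k Bool.≟ true

  tree-and-new : ∀ {k} → Tree k → T0 k ≡ false → ⊥
  tree-and-new t f with trans (sym t) f
  ... | ()

  onPi⇒tree : ∀ {u j} → OnPi G T0 s u j → Tree j
  onPi⇒tree (_ , _ , (w , _) , j∈ks) = All.lookup (walk-edges w) j∈ks

  onPi? : ∀ u j → Dec (OnPi G T0 s u j)
  onPi? u j = ∃-path? _ (λ vs ks → path? tree? s u vs ks ×-dec Any.any? (j Fin.≟_) ks) proj₁

  module Shortest (bfs : IsBFSTree G s T0) where
    open IsBFSTree bfs

    tree-path : ∀ {x ks} → EdgeWalk AllEdges s x ks →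
                ∃₂ λ vs' ks' → Path G Tree s x vs' ks' × length ks' ≤ length ks
    tree-path w with dist-of-walk allEdges? w
    ... | d , dist , d≤ with shortest _ d dist
    ...   | (_ , _ , wT , refl) , _ with walk⇒path wT
    ...     | vs' , ks' , p , sub = vs' , ks' , p , ≤-trans (length-mono-≤ sub) d≤

    tree-path-shortest : ∀ {x vs ks ks'} → Path G Tree s x vs ks → EdgeWalk AllEdges s x ks' →
                         length ks ≤ length ks'
    tree-path-shortest p w with tree-path w
    ... | _ , _ , p' , l with acyclic _ _ _ _ _ _ p p'
    ...   | refl = l

    module Crossings (e : Fin m) where

      record Crossing (x : Fin n) (ks : List (Fin m)) : Set where
        field
          before after : List (Fin m)
          split : ks ≡ before ++ e ∷ after
          e∉after : e ∉ after
          entry exit : Fin n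
          toEntry : EdgeWalk Tree s entry before
          crossing : Step (edge G) e entry exit
          fromExit : EdgeWalk Tree exit x after
      open Crossing

      crossing-of : ∀ {x ks} → EdgeWalk Tree s x ks → e ∈ ks → Crossing x ks
      crossing-of w e∈ks with split-last Fin._≟_ e∈ks
      ... | before , after , refl , e∉after with splitʷ before w
      ...   | entry , toEntry , rest with splitʷ (e ∷ []) rest
      ...     | exit , (_ , cons _ st (nil _)) , fromExit =
        record { before = before ; after = after ; split = refl ; e∉after = e∉after
               ; entry = entry ; exit = exit ; toEntry = toEntry ; crossing = st ; fromExit = fromExit }

      exit-farther : ∀ {x vs ks X} → Path G Tree s x vs ks → (c : Crossing x ks) →
                     EdgeWalk AllEdges s (exit c) X → length (before c) < length X
      exit-farther {ks = ks} {X} p c w = +-cancelʳ-≤ |after| (suc |before|) (length X) (begin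
        suc |before| + |after|                 ≡⟨ +-suc |before| |after| ⟨
        |before| + suc |after|                 ≡⟨ length-++ (before c) ⟨
        length (before c ++ e ∷ after c)       ≡⟨ cong length (split c) ⟨
        length ks                              ≤⟨ tree-path-shortest p (w ++ʷ inG (fromExit c)) ⟩
        length (X ++ after c)                  ≡⟨ length-++ X ⟩
        length X + |after|                     ∎)
        where
        open ≤-Reasoning
        |before| = length (before c)
        |after| = length (after c)

      after-shorter : ∀ {x ks} (c : Crossing x ks) → length (after c) < length ks
      after-shorter {ks = ks} c = begin-strict
        length (after c)                       <⟨ m≤n+m (suc (length (after c))) (length (before c)) ⟩
        length (before c) + length (e ∷ after c) ≡⟨ length-++ (before c) ⟨
        length (before c ++ e ∷ after c)       ≡⟨ cong length (split c) ⟨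
        length ks                              ∎
        where open ≤-Reasoning

      -- Opposite directions would put each exit strictly farther from s than the other.
      crossings-agree : ∀ {x y vs vs' ks ks'} → Path G Tree s x vs ks → Path G Tree s y vs' ks' →
                        (c : Crossing x ks) (c' : Crossing y ks') → exit c ≡ exit c'
      crossings-agree p p' c c' with step-endpoints (crossing c) (crossing c')
      ... | inj₁ same-exit = same-exit
      ... | inj₂ (exit≡entry' , entry≡exit') = contradiction (exit-farther p c reach-exit)
                                                           (<-asym (exit-farther p' c' reach-exit'))
        where
        reach-exit : EdgeWalk AllEdges s (exit c) (before c')
        reach-exit = subst (λ z → EdgeWalk AllEdges s z _) (sym exit≡entry') (inG (toEntry c'))
        reach-exit' : EdgeWalk AllEdges s (exit c') (before c)
        reach-exit' = subst (λ z → EdgeWalk AllEdges s z _) entry≡exit' (inG (toEntry c))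

module Weights {n m : ℕ} (G : Graph n m) (s : Fin n) (T0 : Fin m → Bool) where
  open BFSTree G s T0 using (Tree; onPi?; onPi⇒tree; tree-and-new)

  B base : ℕ
  B = ε₂ n m
  base = n ^ 6 * B

  instance
    B-nonZero : NonZero B
    B-nonZero = m^n≢0 2 (m + 1)

  bit≤B : ∀ (ℓ : Fin m) → 2 ^ (toℕ ℓ + 1) ≤ B
  bit≤B ℓ = ^-monoʳ-≤ 2 (+-monoˡ-≤ 1 (<⇒≤ (Fin.toℕ<n ℓ)))

  B≤ε₁ : B ≤ ε₁ n m
  B≤ε₁ = ≤-trans (m≤m+n B _) (*-monoˡ-≤ B (≤-trans (Fin.toℕ<n s) (n≤n^3 n)))

  edge-weight : ∀ u ℓ → ∃ (EdgeW G T0 s u ℓ)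
  edge-weight u ℓ with T0 ℓ in tℓ | onPi? u ℓ
  ... | true | yes onπ = _ , onpi onπ
  ... | true | no ¬onπ = _ , tree tℓ ¬onπ
  ... | false | _ = _ , other tℓ

  edgeW-functional : ∀ {u ℓ c c'} → EdgeW G T0 s u ℓ c → EdgeW G T0 s u ℓ c' → c ≡ c'
  edgeW-functional (tree _ _) (tree _ _) = refl
  edgeW-functional (onpi _) (onpi _) = refl
  edgeW-functional (other _) (other _) = refl
  edgeW-functional (tree _ ¬onπ) (onpi onπ) = contradiction onπ ¬onπ
  edgeW-functional (onpi onπ) (tree _ ¬onπ) = contradiction onπ ¬onπ
  edgeW-functional (tree t _) (other f) = ⊥-elim (tree-and-new t f)
  edgeW-functional (other f) (tree t _) = ⊥-elim (tree-and-new t f)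
  edgeW-functional (onpi onπ) (other f) = ⊥-elim (tree-and-new (onPi⇒tree onπ) f)
  edgeW-functional (other f) (onpi onπ) = ⊥-elim (tree-and-new (onPi⇒tree onπ) f)

  Wt : Fin n → Fin m → ℕ
  Wt u ℓ = proj₁ (edge-weight u ℓ)

  weight : Fin n → List (Fin m) → ℕ
  weight u ks = sum (map (Wt u) ks)

  pathW-weight : ∀ u ks → PathW G T0 s u ks (weight u ks)
  pathW-weight u [] = []
  pathW-weight u (k ∷ ks) = proj₂ (edge-weight u k) ∷ pathW-weight u ks

  pathW-functional : ∀ {u ks c} → PathW G T0 s u ks c → c ≡ weight u ks
  pathW-functional [] = refl
  pathW-functional {u} (_∷_ {k = k} c p) =
    cong₂ _+_ (edgeW-functional c (proj₂ (edge-weight u k))) (pathW-functional p)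

  Lightest : Fin n → Fin m → List (Fin m) → Set
  Lightest u j ks = ∀ vs' ks' → Path G (Without AllEdges j) s u vs' ks' → weight u ks ≤ weight u ks'

  MinimalPathW : Fin n → Fin m → List (Fin m) → Set
  MinimalPathW u j ks = Σ ℕ λ c → PathW G T0 s u ks c ×
    (∀ vs' ks' c' → Path G (Without AllEdges j) s u vs' ks' → PathW G T0 s u ks' c' → c ≤ c')

  lightest⇒minimal : ∀ {u j ks} → Lightest u j ks → MinimalPathW u j ks
  lightest⇒minimal {u} {ks = ks} lightest =
    weight u ks , pathW-weight u ks ,
    λ vs' ks' _ p pw → subst (_ ≤_) (sym (pathW-functional pw)) (lightest vs' ks' p)

  minimal⇒lightest : ∀ {u j ks} → MinimalPathW u j ks → Lightest u j ks
  minimal⇒lightest {u} (_ , pw , minimal) vs' ks' p =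
    subst (_≤ _) (pathW-functional pw) (minimal vs' ks' _ p (pathW-weight u ks'))

  edgeW-≥ : ∀ {u ℓ c} → EdgeW G T0 s u ℓ c → base ≤ c
  edgeW-≥ (tree _ _) = m≤m+n base _
  edgeW-≥ (onpi _) = ≤-trans (m≤m+n base _) (m≤m+n _ B)
  edgeW-≥ (other _) = ≤-trans (m≤m+n base _) (m≤m+n _ (ε₁ n m))

  edgeW-new-≥ : ∀ {u ℓ c} → T0 ℓ ≡ false → EdgeW G T0 s u ℓ c → base + ε₁ n m ≤ c
  edgeW-new-≥ f (tree t _) = ⊥-elim (tree-and-new t f)
  edgeW-new-≥ f (onpi onπ) = ⊥-elim (tree-and-new (onPi⇒tree onπ) f)
  edgeW-new-≥ f (other _) = +-monoˡ-≤ (ε₁ n m) (m≤m+n base _)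

  edgeW-≤ : ∀ {u ℓ c} → EdgeW G T0 s u ℓ c → c ≤ base + (B + ε₁ n m)
  edgeW-≤ (tree {ℓ} _ _) = +-monoʳ-≤ base (≤-trans (bit≤B ℓ) (m≤m+n B _))
  edgeW-≤ (onpi {ℓ} _) =
    ≤-trans (≤-reflexive (+-assoc base _ B)) (+-monoʳ-≤ base (+-mono-≤ (bit≤B ℓ) B≤ε₁))
  edgeW-≤ (other {ℓ} _) =
    ≤-trans (≤-reflexive (+-assoc base _ _)) (+-monoʳ-≤ base (+-monoˡ-≤ _ (bit≤B ℓ)))

  edgeW-tree-≤ : ∀ {u ℓ c} → Tree ℓ → EdgeW G T0 s u ℓ c → c ≤ base + (B + B)
  edgeW-tree-≤ _ (tree {ℓ} _ _) = +-monoʳ-≤ base (≤-trans (bit≤B ℓ) (m≤m+n B B))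
  edgeW-tree-≤ _ (onpi {ℓ} _) =
    ≤-trans (≤-reflexive (+-assoc base _ B)) (+-monoʳ-≤ base (+-monoˡ-≤ B (bit≤B ℓ)))
  edgeW-tree-≤ t (other f) = ⊥-elim (tree-and-new t f)

  weight-≥ : ∀ u ks → length ks * base ≤ weight u ks
  weight-≥ u = sum-map-≥ (Wt u) λ ℓ → edgeW-≥ (proj₂ (edge-weight u ℓ))

  weight-≤ : ∀ u ks → weight u ks ≤ length ks * (base + (B + ε₁ n m))
  weight-≤ u ks =
    sum-map-≤ (Wt u) (λ {ℓ} _ → edgeW-≤ (proj₂ (edge-weight u ℓ))) (All.universal (λ _ → tt) ks)

  weight-tree-≤ : ∀ u {ks} → All Tree ks → weight u ks ≤ length ks * (base + (B + B))
  weight-tree-≤ u = sum-map-≤ (Wt u) λ {ℓ} t → edgeW-tree-≤ t (proj₂ (edge-weight u ℓ))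

  fewer-edges-lighter : ∀ u ks ks' → length ks < n → length ks < length ks' → weight u ks < weight u ks'
  fewer-edges-lighter u ks ks' ks<n ks<ks' = begin-strict
    weight u ks                                  ≤⟨ weight-≤ u ks ⟩
    q * (base + (B + ε₁ n m))                    ≡⟨ regroup q base B (n ^ 3) ⟩
    q * base + (q + q * n ^ 3) * B               <⟨ +-monoʳ-< (q * base) (*-monoˡ-< B (q+q*n^3<n^6 ks<n)) ⟩
    q * base + base                              ≡⟨ +-comm (q * base) base ⟩
    suc q * base                                 ≤⟨ *-monoˡ-≤ base ks<ks' ⟩
    length ks' * base                            ≤⟨ weight-≥ u ks' ⟩
    weight u ks'                                 ∎
    where
    open ≤-Reasoning
    q = length ks
    regroup : ∀ q b B c → q * (b + (B + c * B)) ≡ q * b + (q + q * c) * B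
    regroup = solve-∀

  tree-lighter-than-new : ∀ u ks pre f → All Tree ks → length ks < n → length ks ≤ suc (length pre) →
                          T0 f ≡ false → weight u ks < weight u pre + Wt u f
  tree-lighter-than-new u ks pre f tree-ks ks<n ks≤ new-f = begin-strict
    weight u ks                                  ≤⟨ weight-tree-≤ u tree-ks ⟩
    t * (base + (B + B))                         ≡⟨ regroup t base B ⟩
    t * base + (t + t) * B
      <⟨ +-mono-≤-< (*-monoˡ-≤ base ks≤) (*-monoˡ-< B (t+t<n^3 ks<n)) ⟩
    suc p * base + ε₁ n m                        ≡⟨ shift p base (ε₁ n m) ⟩
    p * base + (base + ε₁ n m)
      ≤⟨ +-mono-≤ (weight-≥ u pre) (edgeW-new-≥ new-f (proj₂ (edge-weight u f))) ⟩
    weight u pre + Wt u f                        ∎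
    where
    open ≤-Reasoning
    t = length ks
    p = length pre
    regroup : ∀ t b B → t * (b + (B + B)) ≡ t * b + (t + t) * B
    regroup = solve-∀
    shift : ∀ p b c → suc p * b + c ≡ p * b + (b + c)
    shift = solve-∀

module ReplacementPaths {n m : ℕ} (G : Graph n m) (s : Fin n) (T0 : Fin m → Bool)
                        (bfs : IsBFSTree G s T0) (e : Fin m) where
  open Walks G
  open BFSTree G s T0
  open Shortest bfs
  open Crossings e
  open Crossing
  open Weights G s T0

  G∖e H∖e T∖e : EdgeSet m
  G∖e = Without AllEdges e
  H∖e = Without (H G s T0) e
  T∖e = Without Tree e

  T∖e⊆G∖e : ∀ {k} → T∖e k → G∖e k
  T∖e⊆G∖e (_ , k≢e) = tt , k≢e

  T∖e⊆H∖e : ∀ {k} → T∖e k → H∖e k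
  T∖e⊆H∖e (t , k≢e) = inj₁ t , k≢e

  restrict-avoiding : ∀ {A x y ks} → EdgeWalk A x y ks → e ∉ ks → EdgeWalk (Without A e) x y ks
  restrict-avoiding (vs , w) e∉ks =
    vs , walk-restrict (All.zip (walk-edges w , All.map (_∘ sym) (¬Any⇒All¬ _ e∉ks))) w

  restrict-tree : ∀ {x y ks} → All Tree ks → EdgeWalk G∖e x y ks → EdgeWalk T∖e x y ks
  restrict-tree tree-ks (vs , w) = vs , walk-restrict (All.zip (tree-ks , All.map proj₂ (walk-edges w))) w

  PathOfWeight : Fin n → ℕ → Set
  PathOfWeight v c = ∃₂ λ vs ks → Path G G∖e s v vs ks × weight v ks ≡ c

  pathOfWeight? : ∀ v → Decidable (PathOfWeight v)
  pathOfWeight? v c = ∃-path? _ (λ vs ks → path? (without? allEdges? e) s v vs ks ×-dec weight v ks ≟ c) proj₁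

  pstar-exists : ∀ {v vs ks} → Path G G∖e s v vs ks → ∃₂ (IsPStar G T0 s v e)
  pstar-exists {v} p with least (pathOfWeight? v) (_ , _ , p , refl)
  ... | _ , (vs* , ks* , p* , refl) , minimal =
    vs* , ks* , p* , lightest⇒minimal λ vs ks p → minimal (vs , ks , p , refl)

  pstar-minimal : ∀ {u vs* ks* vs ks} → IsPStar G T0 s u e vs* ks* → Path G G∖e s u vs ks →
                  weight u ks* ≤ weight u ks
  pstar-minimal (_ , minimal) p = minimal⇒lightest minimal _ _ p

  pstar-within : ∀ {v L} → WalkWithin G∖e s v L →
                 ∃₂ λ vs* ks* → IsPStar G T0 s v e vs* ks* × length ks* ≤ L
  pstar-within {v} (ks , (vs , w) , l) with walk⇒path w
  ... | _ , ks' , p , sub with pstar-exists p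
  ...   | vs* , ks* , isp = vs* , ks* , isp , ≤-trans fewest (≤-trans (length-mono-≤ sub) l)
    where
    fewest : length ks* ≤ length ks'
    fewest = ≮⇒≥ λ fewer →
      <⇒≱ (fewer-edges-lighter v ks' ks* (path-length< p) fewer) (pstar-minimal isp p)

  first-new-crosses-e : ∀ {v vs* ks* pre f post y vsy ksy} → IsPStar G T0 s v e vs* ks* →
                        ks* ≡ pre ++ f ∷ post → All Tree pre → T0 f ≡ false →
                        EdgeWalk G∖e y v post → Path G Tree s y vsy ksy →
                        length ksy ≤ suc (length pre) → e ∈ ksy
  first-new-crosses-e {v} {pre = pre} {f} {post} {ksy = ksy} isp refl tree-pre new-f fromY py ksy≤ =
    decidable-stable (Any.any? (e Fin.≟_) ksy) shortcut-lighter
    where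
    open ≤-Reasoning
    shortcut-lighter : e ∉ ksy → ⊥
    shortcut-lighter e∉ksy
      with walk⇒path (proj₂ (walk-mono T∖e⊆G∖e (restrict-avoiding (_ , proj₁ py) e∉ksy) ++ʷ fromY))
    ... | _ , ks' , p' , sub = <⇒≱ (begin-strict
      weight v ks'                             ≤⟨ sum-map-mono-⊆ (Wt v) sub ⟩
      weight v (ksy ++ post)                   ≡⟨ sum-map-++ (Wt v) ksy post ⟩
      weight v ksy + weight v post
        <⟨ +-monoˡ-< (weight v post) (tree-lighter-than-new v ksy pre f
                                        (walk-edges (proj₁ py)) (path-length< py) ksy≤ new-f) ⟩
      weight v pre + Wt v f + weight v post    ≡⟨ +-assoc (weight v pre) (Wt v f) (weight v post) ⟩
      weight v pre + weight v (f ∷ post)       ≡⟨ sum-map-++ (Wt v) pre (f ∷ post) ⟨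
      weight v (pre ++ f ∷ post)               ∎) (pstar-minimal isp p')

  crossing-detour : ∀ {y v L vsy ksy vsv ksv} → WalkWithin H∖e s y L →
                    Path G Tree s y vsy ksy → length ksy ≤ L → e ∈ ksy →
                    Path G Tree s v vsv ksv → length ksv ≤ L → e ∈ ksv →
                    WalkWithin H∖e s v (3 * L)
  crossing-detour {y} {v} {L} (ks , toY , l) py ly e∈y pv lv e∈v =
    ks ++ (reverse (after cy) ++ after cv) , toY ++ʷ walk-mono T∖e⊆H∖e (back ++ʷ forth) , bound
    where
    cy = crossing-of (_ , proj₁ py) e∈y
    cv = crossing-of (_ , proj₁ pv) e∈v
    back : EdgeWalk T∖e y (exit cv) (reverse (after cy))
    back = subst (λ z → EdgeWalk T∖e y z _) (crossings-agree py pv cy cv)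
                 (reverseʷ (restrict-avoiding (fromExit cy) (e∉after cy)))
    forth : EdgeWalk T∖e (exit cv) v (after cv)
    forth = restrict-avoiding (fromExit cv) (e∉after cv)
    open ≤-Reasoning
    bound : length (ks ++ (reverse (after cy) ++ after cv)) ≤ 3 * L
    bound = begin
      length (ks ++ (reverse (after cy) ++ after cv))       ≡⟨ length-++ ks ⟩
      length ks + length (reverse (after cy) ++ after cv)
        ≡⟨ cong (length ks +_) (length-++ (reverse (after cy))) ⟩
      length ks + (length (reverse (after cy)) + length (after cv))
        ≡⟨ cong (λ a → length ks + (a + length (after cv))) (length-reverse (after cy)) ⟩
      length ks + (length (after cy) + length (after cv))
        ≤⟨ +-mono-≤ l (+-mono-≤ (≤-trans (<⇒≤ (after-shorter cy)) ly)
                                (≤-trans (<⇒≤ (after-shorter cv)) lv)) ⟩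
      L + (L + L)                                           ≡⟨ cong (λ a → L + (L + a)) (+-identityʳ L) ⟨
      3 * L                                                 ∎

  new-ending-detour : ∀ {v L vsv ksv vs* ks*} → Path G Tree s v vsv ksv → length ksv ≤ L → e ∈ ksv →
                      IsPStar G T0 s v e vs* ks* → length ks* ≤ L → NewEnding T0 ks* →
                      WalkWithin H∖e s v (3 * L)
  new-ending-detour {v} {L} {vsv} {ksv} {vs*} {ks*} pv lv e∈v isp l* ending
    with first-new T0 (new-ending⇒new ending)
  ... | f , first@(pre , post , refl , tree-pre , new-f) with splitʷ pre (_ , proj₁ (proj₁ isp))
  ... | _ , toX , rest with splitʷ (f ∷ []) rest
  ... | y , (_ , cons (_ , f≢e) st (nil _)) , fromY with tree-path (inG (toX ++ʷ edgeʷ (tt , f≢e) st))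
  ... | _ , ksy , py , ly =
    crossing-detour (pre ++ f ∷ [] , toY , toY≤L) py (≤-trans ly toY≤L) e∈ksy pv lv e∈v
    where
    f∈E*new : EStarNew G s T0 f
    f∈E*new = v , e , (vsv , ksv , pv , e∈v) , vs* , ks* , isp , ending , first
    toY : EdgeWalk H∖e s y (pre ++ f ∷ [])
    toY = walk-mono T∖e⊆H∖e (restrict-tree tree-pre toX) ++ʷ edgeʷ (inj₂ f∈E*new , f≢e) st
    toY≤L : length (pre ++ f ∷ []) ≤ L
    toY≤L = begin
      length (pre ++ f ∷ [])        ≡⟨ length-snoc pre f ⟩
      suc (length pre)              ≤⟨ s≤s (length-++-≤ˡ pre) ⟩
      suc (length (pre ++ post))    ≡⟨ length-++-sucʳ pre f post ⟨
      length (pre ++ f ∷ post)      ≤⟨ l* ⟩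
      L                             ∎
      where open ≤-Reasoning
    e∈ksy : e ∈ ksy
    e∈ksy = first-new-crosses-e isp refl tree-pre new-f fromY py
                                (subst (length ksy ≤_) (length-snoc pre f) ly)

  Detours : ℕ → Set
  Detours L = ∀ {v} → WalkWithin G∖e s v L → WalkWithin H∖e s v (3 * L)

  pstar-detour : ∀ {v L vsv ksv vs*} ks* → (∀ {L'} → L' < L → Detours L') →
                 Path G Tree s v vsv ksv → length ksv ≤ L → e ∈ ksv →
                 IsPStar G T0 s v e vs* ks* → length ks* ≤ L → WalkWithin H∖e s v (3 * L)
  pstar-detour {v} {L} ks* shorter pv lv e∈v isp l* with initLast ks*
  ... | [] =
    contradiction (tree-path-shortest pv (inG (_ , proj₁ (proj₁ isp)))) (<⇒≱ (∈⇒length>0 e∈v))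
  ... | pre ∷ʳ′ k with splitʷ pre (_ , proj₁ (proj₁ isp))
  ... | z , toZ , (_ , cons (_ , k≢e) st (nil _)) with T0 k in tk
  ... | false = new-ending-detour pv lv e∈v isp l* (pre , k , refl , tk)
  ... | true = extend (shorter pre<L (pre , toZ , ≤-refl))
    where
    pre<L : length pre < L
    pre<L = subst (_≤ L) (length-snoc pre k) l*
    extend : WalkWithin H∖e s z (3 * length pre) → WalkWithin H∖e s v (3 * L)
    extend (ks' , toZ' , ks'≤) = ks' ++ k ∷ [] , toZ' ++ʷ edgeʷ (inj₁ tk , k≢e) st , (begin
      length (ks' ++ k ∷ [])    ≡⟨ length-snoc ks' k ⟩
      suc (length ks')          ≤⟨ s≤s ks'≤ ⟩
      suc (3 * length pre)      ≤⟨ s≤s (m≤n+m _ 2) ⟩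
      3 + 3 * length pre        ≡⟨ *-suc 3 (length pre) ⟨
      3 * suc (length pre)      ≤⟨ *-monoʳ-≤ 3 pre<L ⟩
      3 * L                     ∎)
      where open ≤-Reasoning

  detour : ∀ L → Detours L
  detour = <-rec Detours step
    where
    step : ∀ L → (∀ {L'} → L' < L → Detours L') → Detours L
    step L shorter w@(ks , walk , l) with tree-path (inG walk)
    ... | _ , ksv , pv , lv with Any.any? (e Fin.≟_) ksv
    ...   | no e∉ksv = ksv , walk-mono T∖e⊆H∖e (restrict-avoiding (_ , proj₁ pv) e∉ksv) ,
                       ≤-trans (≤-trans lv l) (m≤n*m L 3)
    ...   | yes e∈ksv with pstar-within w
    ...     | _ , ks* , isp , l* = pstar-detour ks* shorter pv (≤-trans lv l) e∈ksv isp l*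

-- Extracting a shortest walk of H ∖ e needs decidable membership in E*new.
module Decidability {n m : ℕ} (G : Graph n m) (s : Fin n) (T0 : Fin m → Bool) where
  open Walks G
  open BFSTree G s T0
  open Weights G s T0

  newEnding? : ∀ ks → Dec (NewEnding T0 ks)
  newEnding? ks with initLast ks
  ... | [] = no λ (pre , k , eq , _) → contradiction (++-conicalʳ pre (k ∷ []) (sym eq)) λ ()
  ... | pre ∷ʳ′ k = map′ (λ nk → pre , k , refl , nk) last-new (T0 k Bool.≟ false)
    where
    last-new : NewEnding T0 (pre ++ k ∷ []) → T0 k ≡ false
    last-new (pre' , k' , eq , nk') =
      subst (λ z → T0 z ≡ false) (sym (proj₂ (∷ʳ-injective pre pre' eq))) nk'

  firstNew? : ∀ ks f → Dec (IsFirstNew T0 ks f)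
  firstNew? [] f = no λ { ([] , _ , () , _) ; (_ ∷ _ , _ , () , _) }
  firstNew? (k ∷ ks) f with T0 k in tk
  ... | false = map′ (λ { refl → [] , ks , refl , [] , tk }) here-first (k Fin.≟ f)
    where
    here-first : IsFirstNew T0 (k ∷ ks) f → k ≡ f
    here-first ([] , _ , refl , _ , _) = refl
    here-first (_ ∷ _ , _ , refl , t ∷ _ , _) = ⊥-elim (tree-and-new t tk)
  ... | true = map′ (λ (pre , post , eq , tree-pre , nf) →
                       k ∷ pre , post , cong (k ∷_) eq , tk ∷ tree-pre , nf)
                    later-first (firstNew? ks f)
    where
    later-first : IsFirstNew T0 (k ∷ ks) f → IsFirstNew T0 ks f
    later-first ([] , _ , refl , _ , nf) = ⊥-elim (tree-and-new tk nf)
    later-first (_ ∷ pre , post , refl , _ ∷ tree-pre , nf) = pre , post , refl , tree-pre , nf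

  pstar? : ∀ u j vs ks → Dec (IsPStar G T0 s u j vs ks)
  pstar? u j vs ks =
    path? G∖j? s u vs ks ×-dec map′ lightest⇒minimal minimal⇒lightest
                                    (∀-path? G∖j? s u _ λ _ ks' → weight u ks ≤? weight u ks')
    where G∖j? = without? allEdges? j

  E*new? : Decidable (EStarNew G s T0)
  E*new? f = Fin.any? λ u → Fin.any? λ j → onPi? u j ×-dec
    ∃-path? _ (λ vs ks → pstar? u j vs ks ×-dec newEnding? ks ×-dec firstNew? ks f) (proj₁ ∘ proj₁)

  H? : Decidable (H G s T0)
  H? k = tree? k ⊎-dec E*new? k

lemma2 : {n m : ℕ} (G : Graph n m) (s : Fin n) (T0 : Fin m → Bool) →
         IsBFSTree G s T0 →
         (e : Fin m) (v : Fin n) (d : ℕ) →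
         IsDist G (Without AllEdges e) s v d →
         Σ ℕ (λ d' → IsDist G (Without (H G s T0) e) s v d' × d' ≤ 3 * d)
lemma2 G s T0 bfs e v d ((vs , ks , walk , refl) , _)
  with ReplacementPaths.detour G s T0 bfs e (length ks) (ks , (vs , walk) , ≤-refl)
... | _ , walk' , bound with Walks.dist-of-walk G (without? (Decidability.H? G s T0) e) walk'
...   | d' , dist , d'≤ = d' , dist , ≤-trans d'≤ bound
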